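{- Let $n$ be a positive integer such that $s^{n,4}=\binom{n+1}{2}/4$ is an integer, and let $p_1\le p_2\le p_3\le p_4$ be positive integers with $\sum_{i=1}^4 p_i=n$ satisfying $\sum_{i=1}^{P_j}(n-i+1)\ge j\,s^{n,4}$ for $j=1,\dots,4$, where $P_j=\sum_{i=1}^j p_i$. If there is no equitable partition of $[n]$ implementing $\{p_i\}_{i=1}^4$, then every minimal partition of $[n]$ implementing $\{p_i\}_{i=1}^4$ consists of one low set with sum $s^{n,4}-1$, one high set with sum $s^{n,4}+1$, and two exact sets.
   Context: $[n]=\{1,\dots,n\}$. For a finite set of integers $A$, $S(A)$ denotes the sum of its elements. A partition $\mathcal{A}=\{A_1,\dots,A_4\}$ of $[n]$ implements $\{p_i\}_{i=1}^4$ if the multiset of sizes $\{|A_1|,\dots,|A_4|\}$ equals the multiset $\{p_1,\dots,p_4\}$. It is equitable if $S(A_i)=s^{n,4}$ for all $i$. For a partition $\mathcal{A}$, $d(\mathcal{A})=\sum_{i=1}^4(S(A_i)-s^{n,4})^2$; a minimal partition is a partition implementing $\{p_i\}$ whose $d$-value is minimal among all partitions of $[n]$ implementing $\{p_i\}$. A set $A\in\mathcal{A}$ is low if $S(A)<s^{n,4}$, high if $S(A)>s^{n,4}$, and exact if $S(A)=s^{n,4}$. -}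

module Defs where

open import Data.Nat using (ℕ; zero; suc; _+_; _*_; _∸_; _≤_; _<_; ∣_-_∣)
open import Data.Fin using (Fin; toℕ; _≟_) renaming (zero to f0; suc to fs)
open import Data.List using (List; map; upTo; allFin)
open import Data.Nat.ListAction using (sum)
open import Data.Bool using (if_then_else_)
open import Data.Product using (Σ; _×_)
open import Data.Fin.Permutation using (Permutation′; _⟨$⟩ʳ_)
open import Relation.Nullary.Decidable using (⌊_⌋)

-- A labelled partition of [n] into 4 blocks: element (toℕ x + 1) ∈ [n]
-- (for x : Fin n) is placed into block f x.
Partition4 : ℕ → Set
Partition4 n = Fin n → Fin 4

blockSize : ∀ {n} → Partition4 n → Fin 4 → ℕ
blockSize {n} f k = sum (map (λ x → if ⌊ f x ≟ k ⌋ then 1 else 0) (allFin n))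

blockSum : ∀ {n} → Partition4 n → Fin 4 → ℕ
blockSum {n} f k = sum (map (λ x → if ⌊ f x ≟ k ⌋ then suc (toℕ x) else 0) (allFin n))

Implements : ∀ {n} → Partition4 n → (Fin 4 → ℕ) → Set
Implements f p = Σ (Permutation′ 4) (λ σ → ∀ k → blockSize f (σ ⟨$⟩ʳ k) ≡ p k)
  where open import Relation.Binary.PropositionalEquality using (_≡_)

sq : ℕ → ℕ
sq a = a * a

dval : ∀ {n} → ℕ → Partition4 n → ℕ
dval s f = sq ∣ blockSum f f0 - s ∣ + sq ∣ blockSum f (fs f0) - s ∣
         + sq ∣ blockSum f (fs (fs f0)) - s ∣ + sq ∣ blockSum f (fs (fs (fs f0))) - s ∣

Equitable : ∀ {n} → ℕ → Partition4 n → Set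
Equitable s f = ∀ k → blockSum f k ≡ s
  where open import Relation.Binary.PropositionalEquality using (_≡_)

Minimal : ∀ {n} → ℕ → (Fin 4 → ℕ) → Partition4 n → Set
Minimal {n} s p f = Implements f p × (∀ (g : Partition4 n) → Implements g p → dval s f ≤ dval s g)

-- Σ_{i=1}^{m} (n - i + 1)
topSum : ℕ → ℕ → ℕ
topSum n m = sum (map (λ i → n ∸ i) (upTo m))

-- P_j = p_1 + … + p_j  (j = 1..4, indexed here by Fin 4 as j-1)
prefixP : (Fin 4 → ℕ) → Fin 4 → ℕ
prefixP p f0 = p f0
prefixP p (fs f0) = p f0 + p (fs f0)
prefixP p (fs (fs f0)) = p f0 + p (fs f0) + p (fs (fs f0))
prefixP p (fs (fs (fs f0))) = p f0 + p (fs f0) + p (fs (fs f0)) + p (fs (fs (fs f0)))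

-- Exchanging two consecutive integers y and y + 1 that lie in different blocks A ∋ y + 1 and B ∋ y turns the
-- block sums S(A), S(B) into S(A) − 1, S(B) + 1; by strict convexity of the square this lowers d as soon as
-- S(A) ≥ S(B) + 2. So in a minimal partition the block of y + 1 has sum at most one more than the block of y.
-- Now take a threshold c with some block sum ≤ c and some > c. If no block sum equals c + 1, no element of a
-- low block (sum ≤ c) is followed by an element of a high block, so the j low blocks consist of the largest
-- integers of [n]; since the block sizes are the sorted p permuted, there are at least P_j of them, and the
-- hypothesis makes the low blocks sum to at least j s, which pushes the total above 4 s. Hence the block sums
-- take every value between their minimum and maximum, and four such numbers with sum 4 s, not all equal to s,
-- can only be s − 1, s, s, s + 1.

module Submission where

open import Data.Bool using (Bool; true; false; not; T; if_then_else_)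
open import Data.Empty using (⊥; ⊥-elim)
open import Data.Fin using (Fin; toℕ; fromℕ; fromℕ<; inject₁; punchIn; punchOut; _≟_)
  renaming (zero to f0; suc to fs)
open import Data.Fin.Permutation using (Permutation′; _⟨$⟩ʳ_; _⟨$⟩ˡ_; inverseˡ; transpose)
open import Data.Fin.Properties
  using (any?; all?; ¬∀⟶∃¬; toℕ-fromℕ<; toℕ-inject₁; toℕ-fromℕ; punchIn-punchOut; punchInᵢ≢i;
         punchIn-injective)
open import Data.List using (map; allFin; tabulate; applyUpTo)
open import Data.List.Properties using (map-tabulate; map-applyUpTo)
open import Data.Nat using (ℕ; zero; suc; _+_; _*_; _∸_; _≤_; _<_; z≤n; s≤s; s<s⁻¹; ∣_-_∣)
open import Data.Nat.Combinatorics using (_C_; nC1≡n; nCk+nC[k+1]≡[n+1]C[k+1])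
open import Data.Nat.ListAction using (sum)
open import Data.Nat.Properties
  using (+-*-semiring; _≤?_; module ≤-Reasoning;
         +-assoc; +-comm; +-identityʳ; *-comm; *-distribʳ-+; +-cancelʳ-≡; +-cancelʳ-<;
         ≤-refl; ≤-reflexive; ≤-trans; ≤-antisym; ≤-total; ≤-<-trans; <-trans; <-irrefl; <-cmp; <⇒≤; <⇒≱;
         ≰⇒>; ≮⇒≥; m≤n⇒m<n∨m≡n; n≤1+n; 1+n≢n; m≤m+n; n>0⇒n≢0;
         +-mono-≤; +-monoʳ-≤; +-monoˡ-≤; +-mono-<-≤; +-mono-≤-<; +-monoˡ-<; +-monoʳ-<; *-monoʳ-<;
         m∸n+n≡m; m+[n∸m]≡n; m≤n⇒m∸n≡0; m<n⇒0<n∸m; m∸n≢0⇒n<m; m+n∸n≡m; m+n∸m≡n; ∣m-m+n∣≡n; ∣-∣-comm)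
  renaming (_≟_ to _≟ℕ_)
open import Data.Nat.Tactic.RingSolver using (solve-∀)
open import Data.Product using (Σ; ∃; _×_; _,_; proj₁)
open import Data.Sum using (inj₁; inj₂)
open import Data.Vec.Functional using (Vector)
open import Defs
open import Function using (_∘_)
open import Relation.Binary.Definitions using (tri<; tri≈; tri>)
open import Relation.Binary.PropositionalEquality
open import Relation.Nullary using (¬_; yes; no)
open import Relation.Nullary.Decidable
  using (⌊_⌋; dec-true; dec-false; toWitness; fromWitness; from-yes; _×-dec_; _→-dec_; ¬?; T?)

open import Algebra.Properties.Semiring.Sum +-*-semiring
  using (sum-syntax; sum-cong-≗; sum-remove; sum-init-last; ∑-distrib-+; ∑-comm; ∑-permute)
  renaming (sum to ∑)

select : Bool → ℕ → ℕ
select b v = if b then v else 0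

select-0 : ∀ b → select b 0 ≡ 0
select-0 true  = refl
select-0 false = refl

select-T : ∀ {b} v → T b → select b v ≡ v
select-T {true} v _ = refl

select-≟-refl : ∀ {m} (i : Fin m) v → select ⌊ i ≟ i ⌋ v ≡ v
select-≟-refl i v with i ≟ i
... | yes _   = refl
... | no  i≢i = ⊥-elim (i≢i refl)

select-≟-≢ : ∀ {m} {i j : Fin m} v → i ≢ j → select ⌊ i ≟ j ⌋ v ≡ 0
select-≟-≢ {i = i} {j} v i≢j with i ≟ j
... | yes i≡j = ⊥-elim (i≢j i≡j)
... | no  _   = refl

count : ∀ {n} → Vector Bool n → ℕ
count {n} β = ∑[ k < n ] select (β k) 1

count-≤ : ∀ {n} (β : Vector Bool n) → count β ≤ n
count-≤ {zero}  β = z≤n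
count-≤ {suc n} β = +-mono-≤ (select≤1 (β f0)) (count-≤ (β ∘ fs))
  where
  select≤1 : ∀ b → select b 1 ≤ 1
  select≤1 true  = ≤-refl
  select≤1 false = z≤n

count-* : ∀ {n} (β : Vector Bool n) v → count β * v ≡ ∑[ k < n ] select (β k) v
count-* {zero}  β v = refl
count-* {suc n} β v = trans (*-distribʳ-+ v (select (β f0) 1) (count (β ∘ fs)))
                            (cong₂ _+_ (select-1* (β f0)) (count-* (β ∘ fs) v))
  where
  select-1* : ∀ b → select b 1 * v ≡ select b v
  select-1* true  = +-identityʳ v
  select-1* false = refl

∑-const : ∀ n v → ∑[ k < n ] v ≡ n * v
∑-const zero    v = refl
∑-const (suc n) v = cong (v +_) (∑-const n v)

∑-zero : ∀ {n} {h : Vector ℕ n} → (∀ k → h k ≡ 0) → ∑ h ≡ 0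
∑-zero {zero}  h≗0 = refl
∑-zero {suc n} h≗0 = cong₂ _+_ (h≗0 f0) (∑-zero (h≗0 ∘ fs))

∑-mono-≤ : ∀ {n} {g h : Vector ℕ n} → (∀ k → g k ≤ h k) → ∑ g ≤ ∑ h
∑-mono-≤ {zero}  g≤h = z≤n
∑-mono-≤ {suc n} g≤h = +-mono-≤ (g≤h f0) (∑-mono-≤ (g≤h ∘ fs))

∑-mono-< : ∀ {n} {g h : Vector ℕ n} → (∀ k → g k ≤ h k) → ∀ i → g i < h i → ∑ g < ∑ h
∑-mono-< g≤h f0     gi<hi = +-mono-<-≤ gi<hi (∑-mono-≤ (g≤h ∘ fs))
∑-mono-< g≤h (fs i) gi<hi = +-mono-≤-< (g≤h f0) (∑-mono-< (g≤h ∘ fs) i gi<hi)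

≤-∑ : ∀ {n} (h : Vector ℕ n) i → h i ≤ ∑ h
≤-∑ {suc n} h i = ≤-trans (m≤m+n (h i) _) (≤-reflexive (sym (sum-remove {i = i} h)))

∑-positive : ∀ {n} (h : Vector ℕ n) → 0 < ∑ h → ∃ λ k → 0 < h k
∑-positive {suc n} h pos with h f0 in eq
... | zero  = let k , hk>0 = ∑-positive (h ∘ fs) pos in fs k , hk>0
... | suc _ = f0 , subst (0 <_) (sym eq) (s≤s z≤n)

∑-concentrated : ∀ {n} (h : Vector ℕ n) i → (∀ k → k ≢ i → h k ≡ 0) → ∑ h ≡ h i
∑-concentrated {suc n} h i vanish = begin
  ∑ h                      ≡⟨ sum-remove {i = i} h ⟩
  h i + ∑ (h ∘ punchIn i)  ≡⟨ cong (h i +_) (∑-zero (vanish _ ∘ punchInᵢ≢i i)) ⟩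
  h i + 0                  ≡⟨ +-identityʳ (h i) ⟩
  h i                      ∎
  where open ≡-Reasoning

∑-split₂ : ∀ {n} (h : Vector ℕ (suc (suc n))) {i j} (i≢j : i ≢ j) →
           ∑ h ≡ h i + h j + ∑ (h ∘ punchIn i ∘ punchIn (punchOut i≢j))
∑-split₂ h {i} {j} i≢j = begin
  ∑ h                          ≡⟨ sum-remove {i = i} h ⟩
  h i + ∑ (h ∘ punchIn i)      ≡⟨ cong (h i +_) (sum-remove {i = j′} (h ∘ punchIn i)) ⟩
  h i + (h (punchIn i j′) + R) ≡⟨ cong (λ k → h i + (h k + R)) (punchIn-punchOut i≢j) ⟩
  h i + (h j + R)              ≡⟨ sym (+-assoc (h i) (h j) R) ⟩
  h i + h j + R                ∎
  where
  open ≡-Reasoning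
  j′ : Fin (suc _)
  j′ = punchOut i≢j
  R : ℕ
  R = ∑ (h ∘ punchIn i ∘ punchIn j′)

∑-pair-≤ : ∀ {n} (h : Vector ℕ (suc (suc n))) {i j} → i ≢ j → h i + h j ≤ ∑ h
∑-pair-≤ h i≢j = ≤-trans (m≤m+n _ _) (≤-reflexive (sym (∑-split₂ h i≢j)))

∑-two-point-< : ∀ {n} {g h : Vector ℕ (suc (suc n))} {i j} → i ≢ j →
                (∀ k → k ≢ i → k ≢ j → g k ≡ h k) → g i + g j < h i + h j → ∑ g < ∑ h
∑-two-point-< {g = g} {h} {i} {j} i≢j agree lt = begin-strict
  ∑ g                                        ≡⟨ ∑-split₂ g i≢j ⟩
  g i + g j + ∑ (g ∘ punchIn i ∘ punchIn j′) ≡⟨ cong (g i + g j +_) (sum-cong-≗ rest-agree) ⟩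
  g i + g j + ∑ (h ∘ punchIn i ∘ punchIn j′) <⟨ +-monoˡ-< _ lt ⟩
  h i + h j + ∑ (h ∘ punchIn i ∘ punchIn j′) ≡⟨ sym (∑-split₂ h i≢j) ⟩
  ∑ h                                        ∎
  where
  open ≤-Reasoning
  j′ : Fin (suc _)
  j′ = punchOut i≢j
  rest-agree : ∀ k → g (punchIn i (punchIn j′ k)) ≡ h (punchIn i (punchIn j′ k))
  rest-agree k = agree _ (punchInᵢ≢i i _) λ eq →
    punchInᵢ≢i j′ k (punchIn-injective i _ _ (trans eq (sym (punchIn-punchOut i≢j))))

∑-select-split : ∀ {n} (β : Vector Bool n) (h : Vector ℕ n) →
                 ∑[ k < n ] select (β k) (h k) + ∑[ k < n ] select (not (β k)) (h k) ≡ ∑ h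
∑-select-split β h =
  trans (sym (∑-distrib-+ (λ k → select (β k) (h k)) (λ k → select (not (β k)) (h k)))) (sum-cong-≗ split)
  where
  split : ∀ k → select (β k) (h k) + select (not (β k)) (h k) ≡ h k
  split k with β k
  ... | true  = +-identityʳ (h k)
  ... | false = refl

m∸n+n≡n∸m+m : ∀ m n → m ∸ n + n ≡ n ∸ m + m
m∸n+n≡n∸m+m m n with ≤-total n m
... | inj₁ n≤m = trans (m∸n+n≡m n≤m) (cong (_+ m) (sym (m≤n⇒m∸n≡0 n≤m)))
... | inj₂ m≤n = trans (cong (_+ n) (m≤n⇒m∸n≡0 m≤n)) (sym (m∸n+n≡m m≤n))

∑-excess≡∑-deficit : ∀ {m s} (S : Vector ℕ m) → ∑ S ≡ m * s → ∑[ k < m ] (S k ∸ s) ≡ ∑[ k < m ] (s ∸ S k)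
∑-excess≡∑-deficit {m} {s} S total = +-cancelʳ-≡ (m * s) _ _ (begin
  ∑[ k < m ] (S k ∸ s) + m * s            ≡⟨ cong (∑[ k < m ] (S k ∸ s) +_) (sym (∑-const m s)) ⟩
  ∑[ k < m ] (S k ∸ s) + ∑[ k < m ] s     ≡⟨ sym (∑-distrib-+ (λ k → S k ∸ s) (λ _ → s)) ⟩
  ∑[ k < m ] (S k ∸ s + s)                ≡⟨ sum-cong-≗ (λ k → m∸n+n≡n∸m+m (S k) s) ⟩
  ∑[ k < m ] (s ∸ S k + S k)              ≡⟨ ∑-distrib-+ (λ k → s ∸ S k) S ⟩
  ∑[ k < m ] (s ∸ S k) + ∑ S              ≡⟨ cong (∑[ k < m ] (s ∸ S k) +_) total ⟩
  ∑[ k < m ] (s ∸ S k) + m * s            ∎)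
  where open ≡-Reasoning

sum-allFin : ∀ n (h : Fin n → ℕ) → sum (map h (allFin n)) ≡ ∑ h
sum-allFin n h = trans (cong sum (map-tabulate (λ z → z) h)) (sum-tabulate n h)
  where
  sum-tabulate : ∀ n (h : Fin n → ℕ) → sum (tabulate h) ≡ ∑ h
  sum-tabulate zero    h = refl
  sum-tabulate (suc n) h = cong (h f0 +_) (sum-tabulate n (h ∘ fs))

∑-triangle : ∀ n → ∑[ z < n ] suc (toℕ z) ≡ suc n C 2
∑-triangle zero    = refl
∑-triangle (suc n) = begin
  ∑[ z < suc n ] suc (toℕ z)
    ≡⟨ sum-init-last (λ z → suc (toℕ z)) ⟩
  ∑[ z < n ] suc (toℕ (inject₁ z)) + suc (toℕ (fromℕ n))
    ≡⟨ cong₂ _+_ (sum-cong-≗ {n} (cong suc ∘ toℕ-inject₁)) (cong suc (toℕ-fromℕ n)) ⟩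
  ∑[ z < n ] suc (toℕ z) + suc n
    ≡⟨ cong₂ _+_ (∑-triangle n) (sym (nC1≡n (suc n))) ⟩
  suc n C 2 + suc n C 1
    ≡⟨ +-comm (suc n C 2) _ ⟩
  suc n C 1 + suc n C 2
    ≡⟨ nCk+nC[k+1]≡[n+1]C[k+1] (suc n) 1 ⟩
  suc (suc n) C 2
    ∎
  where open ≡-Reasoning

-- Convexity of the square

m≤n⇒sq∣m-n∣+2mn≡m²+n² : ∀ {m n} → m ≤ n → sq ∣ m - n ∣ + 2 * (m * n) ≡ m * m + n * n
m≤n⇒sq∣m-n∣+2mn≡m²+n² {m} {n} m≤n =
  subst (λ k → sq ∣ m - k ∣ + 2 * (m * k) ≡ m * m + k * k) (m+[n∸m]≡n m≤n) (shifted m (n ∸ m))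
  where
  shifted : ∀ m d → sq ∣ m - m + d ∣ + 2 * (m * (m + d)) ≡ m * m + (m + d) * (m + d)
  shifted m d rewrite ∣m-m+n∣≡n m d = expand m d
    where
    expand : ∀ m d → d * d + 2 * (m * (m + d)) ≡ m * m + (m + d) * (m + d)
    expand = solve-∀

sq∣m-n∣+2mn≡m²+n² : ∀ m n → sq ∣ m - n ∣ + 2 * (m * n) ≡ m * m + n * n
sq∣m-n∣+2mn≡m²+n² m n with ≤-total m n
... | inj₁ m≤n = m≤n⇒sq∣m-n∣+2mn≡m²+n² m≤n
... | inj₂ n≤m = begin
  sq ∣ m - n ∣ + 2 * (m * n) ≡⟨ cong₂ (λ a b → sq a + 2 * b) (∣-∣-comm m n) (*-comm m n) ⟩
  sq ∣ n - m ∣ + 2 * (n * m) ≡⟨ m≤n⇒sq∣m-n∣+2mn≡m²+n² n≤m ⟩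
  n * n + m * m              ≡⟨ +-comm (n * n) (m * m) ⟩
  m * m + n * n              ∎
  where open ≡-Reasoning

-- Adding 2 s (u + v + 1) to both sides turns every sq ∣ x - s ∣ into x * x + s * s.
sq∣-∣-exchange : ∀ s {u v} → v < u → sq ∣ u - s ∣ + sq ∣ suc v - s ∣ < sq ∣ suc u - s ∣ + sq ∣ v - s ∣
sq∣-∣-exchange s {u} {v} v<u = +-cancelʳ-< K _ _ (begin-strict
  F u + F (suc v) + K                                 ≡⟨ shuffleˡ (F u) (F (suc v)) u v s ⟩
  (F u + 2 * (u * s)) + (F (suc v) + 2 * (suc v * s)) ≡⟨ cong₂ _+_ (expand u) (expand (suc v)) ⟩
  (u * u + s * s) + (suc v * suc v + s * s)           ≡⟨ squaresˡ u v s ⟩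
  X + 2 * v                                           <⟨ +-monoʳ-< X (*-monoʳ-< 2 v<u) ⟩
  X + 2 * u                                           ≡⟨ squaresʳ u v s ⟩
  (suc u * suc u + s * s) + (v * v + s * s)           ≡⟨ sym (cong₂ _+_ (expand (suc u)) (expand v)) ⟩
  (F (suc u) + 2 * (suc u * s)) + (F v + 2 * (v * s)) ≡⟨ shuffleʳ (F (suc u)) (F v) u v s ⟩
  F (suc u) + F v + K                                 ∎)
  where
  open ≤-Reasoning
  F : ℕ → ℕ
  F x = sq ∣ x - s ∣
  K X : ℕ
  K = 2 * (u * s) + 2 * (suc v * s)
  X = u * u + v * v + 1 + 2 * (s * s)
  expand : ∀ x → F x + 2 * (x * s) ≡ x * x + s * s
  expand x = sq∣m-n∣+2mn≡m²+n² x s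
  shuffleˡ : ∀ a b u v s → a + b + (2 * (u * s) + 2 * (suc v * s)) ≡ (a + 2 * (u * s)) + (b + 2 * (suc v * s))
  shuffleˡ = solve-∀
  shuffleʳ : ∀ a b u v s → (a + 2 * (suc u * s)) + (b + 2 * (v * s)) ≡ a + b + (2 * (u * s) + 2 * (suc v * s))
  shuffleʳ = solve-∀
  squaresˡ : ∀ u v s → (u * u + s * s) + (suc v * suc v + s * s) ≡ u * u + v * v + 1 + 2 * (s * s) + 2 * v
  squaresˡ = solve-∀
  squaresʳ : ∀ u v s → u * u + v * v + 1 + 2 * (s * s) + 2 * u ≡ (suc u * suc u + s * s) + (v * v + s * s)
  squaresʳ = solve-∀

blockWeight : ∀ {n m} → (Fin n → Fin m) → Vector ℕ n → Fin m → ℕ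
blockWeight {n} f w k = ∑[ z < n ] select ⌊ f z ≟ k ⌋ (w z)

blockSum≡blockWeight : ∀ {n} (f : Partition4 n) k → blockSum f k ≡ blockWeight f (suc ∘ toℕ) k
blockSum≡blockWeight {n} f k = sum-allFin n _

blockSize≡blockWeight : ∀ {n} (f : Partition4 n) k → blockSize f k ≡ blockWeight f (λ _ → 1) k
blockSize≡blockWeight {n} f k = sum-allFin n _

blockWeight-cong : ∀ {n m} (f : Fin n → Fin m) {v w : Vector ℕ n} → (∀ z → v z ≡ w z) → ∀ k →
                   blockWeight f v k ≡ blockWeight f w k
blockWeight-cong f v≗w k = sum-cong-≗ λ z → cong (select ⌊ f z ≟ k ⌋) (v≗w z)

blockWeight-+ : ∀ {n m} (f : Fin n → Fin m) (v w : Vector ℕ n) k →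
                blockWeight f (λ z → v z + w z) k ≡ blockWeight f v k + blockWeight f w k
blockWeight-+ f v w k =
  trans (sum-cong-≗ distrib) (∑-distrib-+ (λ z → select ⌊ f z ≟ k ⌋ (v z)) (λ z → select ⌊ f z ≟ k ⌋ (w z)))
  where
  distrib : ∀ z → select ⌊ f z ≟ k ⌋ (v z + w z) ≡ select ⌊ f z ≟ k ⌋ (v z) + select ⌊ f z ≟ k ⌋ (w z)
  distrib z with f z ≟ k
  ... | yes _ = refl
  ... | no  _ = refl

blockWeight-point : ∀ {n m} (f : Fin n → Fin m) x k →
                    blockWeight f (λ z → select ⌊ z ≟ x ⌋ 1) k ≡ select ⌊ f x ≟ k ⌋ 1
blockWeight-point f x k =
  trans (∑-concentrated (λ z → select ⌊ f z ≟ k ⌋ (select ⌊ z ≟ x ⌋ 1)) x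
           λ z z≢x → trans (cong (select ⌊ f z ≟ k ⌋) (select-≟-≢ 1 z≢x)) (select-0 _))
        (cong (select ⌊ f x ≟ k ⌋) (select-≟-refl x 1))

blockWeight-relabel : ∀ {n m} (f : Fin n → Fin m) (π : Permutation′ n) w k →
                      blockWeight (f ∘ (π ⟨$⟩ʳ_)) w k ≡ blockWeight f (w ∘ (π ⟨$⟩ˡ_)) k
blockWeight-relabel f π w k =
  sym (trans (∑-permute (λ z → select ⌊ f z ≟ k ⌋ (w (π ⟨$⟩ˡ z))) π)
             (sum-cong-≗ λ z → cong (λ z′ → select ⌊ f (π ⟨$⟩ʳ z) ≟ k ⌋ (w z′)) (inverseˡ π)))

blockWeight-regroup : ∀ {n m} (f : Fin n → Fin m) (β : Vector Bool m) (w : Vector ℕ n) →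
                      ∑[ k < m ] select (β k) (blockWeight f w k) ≡ ∑[ z < n ] select (β (f z)) (w z)
blockWeight-regroup {n} {m} f β w = begin
  ∑[ k < m ] select (β k) (blockWeight f w k) ≡⟨ sum-cong-≗ (λ k → select-∑ (β k) _) ⟩
  ∑[ k < m ] ∑[ z < n ] term k z              ≡⟨ ∑-comm term ⟩
  ∑[ z < n ] ∑[ k < m ] term k z              ≡⟨ sum-cong-≗ atBlock ⟩
  ∑[ z < n ] select (β (f z)) (w z)           ∎
  where
  open ≡-Reasoning
  term : Fin m → Fin n → ℕ
  term k z = select (β k) (select ⌊ f z ≟ k ⌋ (w z))
  select-∑ : ∀ b (h : Vector ℕ n) → select b (∑ h) ≡ ∑[ z < n ] select b (h z)
  select-∑ true  h = refl
  select-∑ false h = sym (∑-zero {h = λ z → select false (h z)} λ _ → refl)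
  atBlock : ∀ z → ∑[ k < m ] term k z ≡ select (β (f z)) (w z)
  atBlock z = trans (∑-concentrated (λ k → term k z) (f z) elsewhere)
                    (cong (select (β (f z))) (select-≟-refl (f z) (w z)))
    where
    elsewhere : ∀ k → k ≢ f z → term k z ≡ 0
    elsewhere k k≢fz = trans (cong (select (β k)) (select-≟-≢ (w z) (k≢fz ∘ sym))) (select-0 (β k))

∑-blockSum : ∀ {n} (f : Partition4 n) → ∑[ k < 4 ] blockSum f k ≡ suc n C 2
∑-blockSum {n} f = begin
  ∑[ k < 4 ] blockSum f k                   ≡⟨ sum-cong-≗ (blockSum≡blockWeight f) ⟩
  ∑[ k < 4 ] blockWeight f (suc ∘ toℕ) k    ≡⟨ blockWeight-regroup f (λ _ → true) (suc ∘ toℕ) ⟩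
  ∑[ z < n ] suc (toℕ z)                    ≡⟨ ∑-triangle n ⟩
  suc n C 2                                 ∎
  where open ≡-Reasoning

-- Exchanging two consecutive elements

transpose-shift : ∀ {n} (w : Vector ℕ n) {x y} → x ≢ y → w x ≡ suc (w y) →
                  ∀ z → w (transpose x y ⟨$⟩ˡ z) + select ⌊ z ≟ x ⌋ 1 ≡ w z + select ⌊ z ≟ y ⌋ 1
transpose-shift w {x} {y} x≢y wx≡1+wy z with z ≟ y | z ≟ x
... | yes refl | yes refl = ⊥-elim (x≢y refl)
... | yes refl | no  _    = trans (+-identityʳ _) (trans wx≡1+wy (+-comm 1 (w z)))
... | no  _    | yes refl rewrite dec-true (z ≟ z) refl =
  sym (trans (+-identityʳ _) (trans wx≡1+wy (+-comm 1 _)))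
... | no  _    | no  z≢x  rewrite dec-false (z ≟ x) z≢x = refl

exchange : ∀ {n} → Partition4 n → Fin n → Fin n → Partition4 n
exchange f x y = f ∘ (transpose x y ⟨$⟩ʳ_)

exchange-implements : ∀ {n} {f : Partition4 n} {p} x y → Implements f p → Implements (exchange f x y) p
exchange-implements {f = f} x y (σ , sizes) = σ , λ k → trans (sameSize _) (sizes k)
  where
  sameSize : ∀ k → blockSize (exchange f x y) k ≡ blockSize f k
  sameSize k = trans (blockSize≡blockWeight (exchange f x y) k)
                 (trans (blockWeight-relabel f (transpose x y) (λ _ → 1) k) (sym (blockSize≡blockWeight f k)))

-- Relabelling by the transposition swaps the weights of x and y, moving one unit from block f x to f y.
exchange-shift : ∀ {n} (f : Partition4 n) {x y} → x ≢ y → toℕ x ≡ suc (toℕ y) → ∀ k →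
                 blockSum (exchange f x y) k + select ⌊ f x ≟ k ⌋ 1 ≡ blockSum f k + select ⌊ f y ≟ k ⌋ 1
exchange-shift f {x} {y} x≢y x=y+1 k = begin
  blockSum (exchange f x y) k + select ⌊ f x ≟ k ⌋ 1
    ≡⟨ cong₂ _+_ (trans (blockSum≡blockWeight (exchange f x y) k) (blockWeight-relabel f τ w k))
                 (sym (blockWeight-point f x k)) ⟩
  blockWeight f (w ∘ (τ ⟨$⟩ˡ_)) k + blockWeight f (indicator x) k
    ≡⟨ sym (blockWeight-+ f (w ∘ (τ ⟨$⟩ˡ_)) (indicator x) k) ⟩
  blockWeight f (λ z → w (τ ⟨$⟩ˡ z) + indicator x z) k
    ≡⟨ blockWeight-cong f (transpose-shift w x≢y (cong suc x=y+1)) k ⟩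
  blockWeight f (λ z → w z + indicator y z) k
    ≡⟨ blockWeight-+ f w (indicator y) k ⟩
  blockWeight f w k + blockWeight f (indicator y) k
    ≡⟨ cong₂ _+_ (sym (blockSum≡blockWeight f k)) (blockWeight-point f y k) ⟩
  blockSum f k + select ⌊ f y ≟ k ⌋ 1
    ∎
  where
  open ≡-Reasoning
  τ : Permutation′ _
  τ = transpose x y
  w : Vector ℕ _
  w = suc ∘ toℕ
  indicator : Fin _ → Vector ℕ _
  indicator a z = select ⌊ z ≟ a ⌋ 1

dval≡∑ : ∀ {n} s (f : Partition4 n) → dval s f ≡ ∑[ k < 4 ] sq ∣ blockSum f k - s ∣
dval≡∑ s f = reassoc (F f0) (F (fs f0)) (F (fs (fs f0))) (F (fs (fs (fs f0))))
  where
  F : Fin 4 → ℕ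
  F k = sq ∣ blockSum f k - s ∣
  reassoc : ∀ a b c d → a + b + c + d ≡ a + (b + (c + (d + 0)))
  reassoc = solve-∀

exchange-improves : ∀ {n} s (f : Partition4 n) {x y} → toℕ x ≡ suc (toℕ y) → f x ≢ f y →
                    suc (blockSum f (f y)) < blockSum f (f x) → dval s (exchange f x y) < dval s f
exchange-improves s f {x} {y} x=y+1 A≢B gap = begin-strict
  dval s g                     ≡⟨ dval≡∑ s g ⟩
  ∑[ k < 4 ] F (blockSum g k)  <⟨ ∑-two-point-< A≢B unchanged improved ⟩
  ∑[ k < 4 ] F (blockSum f k)  ≡⟨ sym (dval≡∑ s f) ⟩
  dval s f                     ∎
  where
  open ≤-Reasoning
  A B : Fin 4
  A = f x
  B = f y
  g : Partition4 _
  g = exchange f x y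
  F : ℕ → ℕ
  F u = sq ∣ u - s ∣
  x≢y : x ≢ y
  x≢y refl = 1+n≢n (sym x=y+1)
  shift : ∀ k → blockSum g k + select ⌊ A ≟ k ⌋ 1 ≡ blockSum f k + select ⌊ B ≟ k ⌋ 1
  shift = exchange-shift f x≢y x=y+1
  shiftA : blockSum g A + 1 ≡ blockSum f A + 0
  shiftA = subst₂ (λ a b → blockSum g A + a ≡ blockSum f A + b)
                  (select-≟-refl A 1) (select-≟-≢ 1 (A≢B ∘ sym)) (shift A)
  shiftB : blockSum g B + 0 ≡ blockSum f B + 1
  shiftB = subst₂ (λ a b → blockSum g B + a ≡ blockSum f B + b)
                  (select-≟-≢ 1 A≢B) (select-≟-refl B 1) (shift B)
  unchanged : ∀ k → k ≢ A → k ≢ B → F (blockSum g k) ≡ F (blockSum f k)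
  unchanged k k≢A k≢B = cong F (+-cancelʳ-≡ 0 _ _
    (subst₂ (λ a b → blockSum g k + a ≡ blockSum f k + b)
            (select-≟-≢ 1 (k≢A ∘ sym)) (select-≟-≢ 1 (k≢B ∘ sym)) (shift k)))
  fromA : blockSum f A ≡ suc (blockSum g A)
  fromA = trans (sym (+-identityʳ _)) (trans (sym shiftA) (+-comm _ 1))
  toB : blockSum g B ≡ suc (blockSum f B)
  toB = trans (sym (+-identityʳ _)) (trans shiftB (+-comm _ 1))
  improved : F (blockSum g A) + F (blockSum g B) < F (blockSum f A) + F (blockSum f B)
  improved = subst₂ (λ b a → F (blockSum g A) + F b < F a + F (blockSum f B)) (sym toB) (sym fromA)
                    (sq∣-∣-exchange s (s<s⁻¹ (subst (suc (blockSum f B) <_) fromA gap)))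

minimal⇒adjacent-close : ∀ {n s p} {f : Partition4 n} → Minimal s p f →
                         ∀ x y → toℕ x ≡ suc (toℕ y) → blockSum f (f x) ≤ suc (blockSum f (f y))
minimal⇒adjacent-close {s = s} {f = f} (implements , least) x y x=y+1 with f x ≟ f y
... | yes fx≡fy = subst (λ k → blockSum f k ≤ suc (blockSum f (f y))) (sym fx≡fy) (n≤1+n _)
... | no  fx≢fy = ≮⇒≥ λ gap →
  <⇒≱ (exchange-improves s f x=y+1 fx≢fy gap) (least (exchange f x y) (exchange-implements x y implements))

-- The block sums of a minimal partition have no gaps

topSum≡sum-applyUpTo : ∀ n m → topSum n m ≡ sum (applyUpTo (n ∸_) m)
topSum≡sum-applyUpTo n m = cong sum (map-applyUpTo (λ i → i) (n ∸_) m)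

topSum-suc : ∀ n m → topSum (suc n) (suc m) ≡ suc n + topSum n m
topSum-suc n m =
  trans (topSum≡sum-applyUpTo (suc n) (suc m)) (cong (suc n +_) (sym (topSum≡sum-applyUpTo n m)))

topSum-mono : ∀ n {m m′} → m ≤ m′ → topSum n m ≤ topSum n m′
topSum-mono n {m} {m′} m≤m′ =
  subst₂ _≤_ (sym (topSum≡sum-applyUpTo n m)) (sym (topSum≡sum-applyUpTo n m′)) (sum-applyUpTo-mono (n ∸_) m≤m′)
  where
  sum-applyUpTo-mono : ∀ (g : ℕ → ℕ) {m m′} → m ≤ m′ → sum (applyUpTo g m) ≤ sum (applyUpTo g m′)
  sum-applyUpTo-mono g z≤n        = z≤n
  sum-applyUpTo-mono g (s≤s m≤m′) = +-monoʳ-≤ (g 0) (sum-applyUpTo-mono (g ∘ suc) m≤m′)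

UpClosed : ∀ {n} → Vector Bool n → Set
UpClosed P = ∀ x y → toℕ x ≡ suc (toℕ y) → T (P y) → T (P x)

upClosed-last : ∀ {n} {P : Vector Bool (suc n)} → UpClosed P → ∀ z → T (P z) → T (P (fromℕ n))
upClosed-last {zero}  cl f0     Pz = Pz
upClosed-last {suc n} cl f0     Pz = upClosed-last (λ x y → cl (fs x) (fs y) ∘ cong suc) f0 (cl (fs f0) f0 refl Pz)
upClosed-last {suc n} cl (fs z) Pz = upClosed-last (λ x y → cl (fs x) (fs y) ∘ cong suc) z Pz

upClosed⇒topSum≤ : ∀ {n} (P : Vector Bool n) → UpClosed P →
                   topSum n (count P) ≤ ∑[ z < n ] select (P z) (suc (toℕ z))
upClosed⇒topSum≤ {zero}  P cl = z≤n
upClosed⇒topSum≤ {suc n} P cl with P (fromℕ n) in lastP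
... | true  = begin
  topSum (suc n) (count P)                         ≡⟨ cong (topSum (suc n)) countP ⟩
  topSum (suc n) (suc (count P′))                  ≡⟨ topSum-suc n (count P′) ⟩
  suc n + topSum n (count P′)                      ≤⟨ +-monoʳ-≤ (suc n) (upClosed⇒topSum≤ P′ closed′) ⟩
  suc n + ∑[ z < n ] select (P′ z) (suc (toℕ z))   ≡⟨ sumP ⟩
  ∑[ z < suc n ] select (P z) (suc (toℕ z))        ∎
  where
  open ≤-Reasoning
  P′ : Vector Bool n
  P′ = P ∘ inject₁
  closed′ : UpClosed P′
  closed′ x y x=y+1 =
    cl (inject₁ x) (inject₁ y) (trans (toℕ-inject₁ x) (trans x=y+1 (cong suc (sym (toℕ-inject₁ y)))))
  countP : count P ≡ suc (count P′)
  countP = trans (sum-init-last (λ z → select (P z) 1))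
                 (trans (cong (λ b → count P′ + select b 1) lastP) (+-comm _ 1))
  sumP : suc n + ∑[ z < n ] select (P′ z) (suc (toℕ z)) ≡ ∑[ z < suc n ] select (P z) (suc (toℕ z))
  sumP = sym (trans (sum-init-last (λ z → select (P z) (suc (toℕ z))))
                    (trans (cong₂ _+_ (sum-cong-≗ {n} λ z → cong (select (P′ z) ∘ suc) (toℕ-inject₁ z))
                                      (cong₂ (λ b v → select b (suc v)) lastP (toℕ-fromℕ n)))
                           (+-comm _ (suc n))))
... | false =
  subst (λ c → topSum (suc n) c ≤ ∑[ z < suc n ] select (P z) (suc (toℕ z))) (sym (∑-zero none)) z≤n
  where
  none : ∀ z → select (P z) 1 ≡ 0
  none z with P z in Pz
  ... | true  = ⊥-elim (subst T lastP (upClosed-last cl z (subst T (sym Pz) _)))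
  ... | false = refl

prefixSum : ∀ {n} → ℕ → Vector ℕ n → ℕ
prefixSum {zero}  _       _ = 0
prefixSum {suc n} zero    _ = 0
prefixSum {suc n} (suc r) p = p f0 + prefixSum r (p ∘ fs)

NonDecreasing : ∀ {n} → Vector ℕ (suc n) → Set
NonDecreasing {n} p = ∀ (k : Fin n) → p (inject₁ k) ≤ p (fs k)

prefixSum-shift : ∀ {n r} (p : Vector ℕ (suc n)) → NonDecreasing p → r ≤ n →
                  prefixSum r p ≤ prefixSum r (p ∘ fs)
prefixSum-shift {r = zero}      p mono z≤n       = z≤n
prefixSum-shift {suc n} {suc r} p mono (s≤s r≤n) = +-mono-≤ (mono f0) (prefixSum-shift (p ∘ fs) (mono ∘ fs) r≤n)

prefixSum≤selection : ∀ {n} (p : Vector ℕ (suc n)) (β : Vector Bool (suc n)) → NonDecreasing p →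
                      prefixSum (count β) p ≤ ∑[ k < suc n ] select (β k) (p k)
prefixSum≤selection {zero} p β mono with β f0
... | true  = ≤-refl
... | false = z≤n
prefixSum≤selection {suc n} p β mono with β f0
... | true  = +-monoʳ-≤ (p f0) (prefixSum≤selection (p ∘ fs) (β ∘ fs) (mono ∘ fs))
... | false = ≤-trans (prefixSum-shift p mono (count-≤ (β ∘ fs)))
                      (prefixSum≤selection (p ∘ fs) (β ∘ fs) (mono ∘ fs))

prefixP≡prefixSum : ∀ p j → prefixP p j ≡ prefixSum (suc (toℕ j)) p
prefixP≡prefixSum p f0                = sym (+-identityʳ _)
prefixP≡prefixSum p (fs f0)           = cong (p f0 +_) (sym (+-identityʳ _))
prefixP≡prefixSum p (fs (fs f0))      = reassoc (p f0) (p (fs f0)) (p (fs (fs f0)))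
  where
  reassoc : ∀ a b c → a + b + c ≡ a + (b + (c + 0))
  reassoc = solve-∀
prefixP≡prefixSum p (fs (fs (fs f0))) = reassoc (p f0) (p (fs f0)) (p (fs (fs f0))) (p (fs (fs (fs f0))))
  where
  reassoc : ∀ a b c d → a + b + c + d ≡ a + (b + (c + (d + 0)))
  reassoc = solve-∀

atMost : ∀ {m} → ℕ → Vector ℕ m → Vector Bool m
atMost c S k = ⌊ S k ≤? c ⌋

lowerPart-belowMean : ∀ {m s c} (S : Vector ℕ m) → ∑ S ≡ m * s → ∀ {lo hi} → S lo ≤ c → c < S hi →
                      ∑[ k < m ] select (atMost c S k) (S k) < count (atMost c S) * s
lowerPart-belowMean {m} {s} {c} S total {lo} {hi} lo≤c c<hi rewrite count-* (atMost c S) s = ≰⇒> impossible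
  where
  low high : Vector Bool m
  low = atMost c S
  high = not ∘ low
  low≤ : c < s → ∀ k → select (low k) (S k) ≤ select (low k) s
  low≤ c<s k with S k ≤? c
  ... | yes Sk≤c = <⇒≤ (≤-<-trans Sk≤c c<s)
  ... | no  _    = z≤n
  low< : c < s → select (low lo) (S lo) < select (low lo) s
  low< c<s with S lo ≤? c
  ... | yes _    = ≤-<-trans lo≤c c<s
  ... | no  lo≰c = ⊥-elim (lo≰c lo≤c)
  high≥ : s ≤ c → ∀ k → select (high k) s ≤ select (high k) (S k)
  high≥ s≤c k with S k ≤? c
  ... | yes _    = z≤n
  ... | no  Sk≰c = ≤-trans s≤c (<⇒≤ (≰⇒> Sk≰c))
  high> : s ≤ c → select (high hi) s < select (high hi) (S hi)
  high> s≤c with S hi ≤? c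
  ... | yes hi≤c = ⊥-elim (<⇒≱ c<hi hi≤c)
  ... | no  _    = ≤-<-trans s≤c c<hi
  impossible : ∑[ k < m ] select (low k) s ≤ ∑[ k < m ] select (low k) (S k) → ⊥
  impossible share≤low = <-irrefl refl (begin-strict
    m * s                                                  ≡⟨ sym (∑-const m s) ⟩
    ∑[ k < m ] s                                           ≡⟨ sym (∑-select-split low (λ _ → s)) ⟩
    ∑[ k < m ] select (low k) s + ∑[ k < m ] select (high k) s
      ≤⟨ +-monoˡ-≤ _ share≤low ⟩
    ∑[ k < m ] select (low k) (S k) + ∑[ k < m ] select (high k) s
      <⟨ +-monoʳ-< _ (∑-mono-< (high≥ s≤c) hi (high> s≤c)) ⟩
    ∑[ k < m ] select (low k) (S k) + ∑[ k < m ] select (high k) (S k)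
      ≡⟨ ∑-select-split low S ⟩
    ∑ S                                                    ≡⟨ total ⟩
    m * s                                                  ∎)
    where
    open ≤-Reasoning
    s≤c : s ≤ c
    s≤c = ≮⇒≥ λ c<s → <⇒≱ (∑-mono-< (low≤ c<s) lo (low< c<s)) share≤low

GapFree : ∀ {m} → Vector ℕ m → Set
GapFree S = ∀ c → (∃ λ k → S k ≤ c) → (∃ λ k → c < S k) → ∃ λ k → S k ≡ suc c

module _ {n s} {p : Fin 4 → ℕ} (sorted : NonDecreasing p)
         (prefixBound : ∀ j → suc (toℕ j) * s ≤ topSum n (prefixP p j)) where

  prefixSum-bound : ∀ {r} → 0 < r → r ≤ 4 → r * s ≤ topSum n (prefixSum r p)
  prefixSum-bound {suc r} _ r<4 =
    subst (λ t → suc t * s ≤ topSum n (prefixSum (suc t) p)) (toℕ-fromℕ< r<4)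
          (subst (λ b → suc (toℕ j) * s ≤ topSum n b) (prefixP≡prefixSum p j) (prefixBound j))
    where j = fromℕ< r<4

  upClosedBlocks-aboveMean : ∀ {f : Partition4 n} → Implements f p → (β : Vector Bool 4) →
                             ∀ lo → T (β lo) → UpClosed (β ∘ f) →
                             count β * s ≤ ∑[ k < 4 ] select (β k) (blockSum f k)
  upClosedBlocks-aboveMean {f} (σ , sizes) β lo βlo closed = begin
    count β * s                                ≡⟨ cong (_* s) countσ ⟩
    count βσ * s                               ≤⟨ prefixSum-bound countσ-positive (count-≤ βσ) ⟩
    topSum n (prefixSum (count βσ) p)          ≤⟨ topSum-mono n (prefixSum≤selection p βσ sorted) ⟩
    topSum n (∑[ k < 4 ] select (βσ k) (p k))  ≡⟨ cong (topSum n) elements ⟩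
    topSum n (count (β ∘ f))                   ≤⟨ upClosed⇒topSum≤ (β ∘ f) closed ⟩
    ∑[ z < n ] select (β (f z)) (suc (toℕ z))  ≡⟨ weights ⟩
    ∑[ k < 4 ] select (β k) (blockSum f k)     ∎
    where
    open ≤-Reasoning
    βσ : Vector Bool 4
    βσ = β ∘ (σ ⟨$⟩ʳ_)
    countσ : count β ≡ count βσ
    countσ = ∑-permute (λ k → select (β k) 1) σ
    countσ-positive : 0 < count βσ
    countσ-positive = subst (0 <_) countσ
      (≤-trans (≤-reflexive (sym (select-T 1 βlo))) (≤-∑ (λ k → select (β k) 1) lo))
    elements : ∑[ k < 4 ] select (βσ k) (p k) ≡ count (β ∘ f)
    elements = ≡.begin
      ∑[ k < 4 ] select (βσ k) (p k)
        ≡.≡⟨ sum-cong-≗ (λ k → cong (select (βσ k)) (sym (sizes k))) ⟩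
      ∑[ k < 4 ] select (βσ k) (blockSize f (σ ⟨$⟩ʳ k))
        ≡.≡⟨ sym (∑-permute (λ k → select (β k) (blockSize f k)) σ) ⟩
      ∑[ k < 4 ] select (β k) (blockSize f k)
        ≡.≡⟨ sum-cong-≗ (λ k → cong (select (β k)) (blockSize≡blockWeight f k)) ⟩
      ∑[ k < 4 ] select (β k) (blockWeight f (λ _ → 1) k)
        ≡.≡⟨ blockWeight-regroup f β (λ _ → 1) ⟩
      count (β ∘ f)
        ≡.∎
      where module ≡ = ≡-Reasoning
    weights : ∑[ z < n ] select (β (f z)) (suc (toℕ z)) ≡ ∑[ k < 4 ] select (β k) (blockSum f k)
    weights = sym (trans (sum-cong-≗ (λ k → cong (select (β k)) (blockSum≡blockWeight f k)))
                         (blockWeight-regroup f β (suc ∘ toℕ)))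

  minimal⇒gapFree : ∀ {f : Partition4 n} → ∑[ k < 4 ] blockSum f k ≡ 4 * s → Minimal s p f →
                    GapFree (blockSum f)
  minimal⇒gapFree {f} total minimal c (lo , lo≤c) (hi , c<hi)
    with any? (λ x → any? λ y → toℕ x ≟ℕ suc (toℕ y) ×-dec T? (atMost c (blockSum f) (f y))
                                                        ×-dec ¬? (T? (atMost c (blockSum f) (f x))))
  ... | yes (x , y , x=y+1 , y-low , x-high) =
    f x , ≤-antisym (≤-trans (minimal⇒adjacent-close minimal x y x=y+1) (s≤s (toWitness y-low)))
                    (≰⇒> (x-high ∘ fromWitness))
  ... | no noCrossing = ⊥-elim (<⇒≱ (lowerPart-belowMean (blockSum f) total lo≤c c<hi)
                                    (upClosedBlocks-aboveMean (proj₁ minimal) (atMost c (blockSum f)) lo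
                                                              (fromWitness lo≤c) closed))
    where
    closed : UpClosed (atMost c (blockSum f) ∘ f)
    closed x y x=y+1 y-low with T? (atMost c (blockSum f) (f x))
    ... | yes x-low  = x-low
    ... | no  x-high = ⊥-elim (noCrossing (x , y , x=y+1 , y-low , x-high))

-- Four block sums without gaps

gapFree-attains : ∀ {m} {S : Vector ℕ m} → GapFree S → ∀ {i j v} → S i ≤ v → v ≤ S j → ∃ λ k → S k ≡ v
gapFree-attains gapFree {i} {j} Si≤v v≤Sj with m≤n⇒m<n∨m≡n Si≤v
... | inj₂ Si≡v       = i , Si≡v
... | inj₁ (s≤s Si≤c) = gapFree _ (i , Si≤c) (j , v≤Sj)

Exhaustive : (a b c d : Fin 4) → Set
Exhaustive a b c d = a ≢ b → a ≢ c → a ≢ d → b ≢ c → b ≢ d → c ≢ d → ∀ k → k ≢ a → k ≢ b → k ≢ c → k ≡ d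

fin4-exhaustive : ∀ a b c d → Exhaustive a b c d
fin4-exhaustive = from-yes (all? {P = λ a → ∀ b c d → Exhaustive a b c d} λ a → all? λ b → all? λ c → all? λ d →
  ¬? (a ≟ b) →-dec ¬? (a ≟ c) →-dec ¬? (a ≟ d) →-dec ¬? (b ≟ c) →-dec ¬? (b ≟ d) →-dec ¬? (c ≟ d) →-dec
  all? λ k → ¬? (k ≟ a) →-dec ¬? (k ≟ b) →-dec ¬? (k ≟ c) →-dec k ≟ d)

∑-vanishing-on-three : ∀ {a b c d : Fin 4} → a ≢ b → a ≢ c → a ≢ d → b ≢ c → b ≢ d → c ≢ d →
                       (h : Vector ℕ 4) → h a ≡ 0 → h b ≡ 0 → h c ≡ 0 → ∑ h ≡ h d
∑-vanishing-on-three {a} {b} {c} {d} a≢b a≢c a≢d b≢c b≢d c≢d h ha hb hc = ∑-concentrated h d vanish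
  where
  vanish : ∀ k → k ≢ d → h k ≡ 0
  vanish k k≢d with k ≟ a | k ≟ b | k ≟ c
  ... | yes refl | _        | _        = ha
  ... | no  _    | yes refl | _        = hb
  ... | no  _    | no  _    | yes refl = hc
  ... | no  k≢a  | no  k≢b  | no  k≢c  =
    ⊥-elim (k≢d (fin4-exhaustive a b c d a≢b a≢c a≢d b≢c b≢d c≢d k k≢a k≢b k≢c))

AlmostEquitable : ℕ → Vector ℕ 4 → Set
AlmostEquitable s S = Σ (Fin 4) λ i → Σ (Fin 4) λ j →
  i ≢ j × S i + 1 ≡ s × S j ≡ s + 1 × (∀ k → k ≢ i → k ≢ j → S k ≡ s)

module _ {s} {S : Vector ℕ 4} (total : ∑ S ≡ 4 * s) (gapFree : GapFree S) where

  private
    excess deficit : Vector ℕ 4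
    excess k = S k ∸ s
    deficit k = s ∸ S k

    balance : ∑ excess ≡ ∑ deficit
    balance = ∑-excess≡∑-deficit S total

    apart : ∀ {a b} → S a < S b → a ≢ b
    apart Sa<Sb refl = <-irrefl refl Sa<Sb

    someAbove : 0 < ∑ excess → ∃ λ k → s < S k
    someAbove pos = let k , excess>0 = ∑-positive excess pos in k , m∸n≢0⇒n<m (n>0⇒n≢0 excess>0)

    someBelow : 0 < ∑ deficit → ∃ λ k → S k < s
    someBelow pos = let k , deficit>0 = ∑-positive deficit pos in k , m∸n≢0⇒n<m (n>0⇒n≢0 deficit>0)

    low-and-high : ¬ (∀ k → S k ≡ s) → (∃ λ k → S k < s) × (∃ λ k → s < S k)
    low-and-high ¬exact with ¬∀⟶∃¬ 4 (λ k → S k ≡ s) (λ k → S k ≟ℕ s) ¬exact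
    ... | k , Sk≢s with <-cmp (S k) s
    ... | tri< Sk<s _ _ = (k , Sk<s) ,
                          someAbove (subst (0 <_) (sym balance) (≤-trans (m<n⇒0<n∸m Sk<s) (≤-∑ deficit k)))
    ... | tri≈ _ Sk≡s _ = ⊥-elim (Sk≢s Sk≡s)
    ... | tri> _ _ s<Sk = someBelow (subst (0 <_) balance (≤-trans (m<n⇒0<n∸m s<Sk) (≤-∑ excess k))) ,
                          (k , s<Sk)

    no-two-below : ∑ excess ≡ 1 → ∀ {a b} → a ≢ b → S a < s → S b < s → ⊥
    no-two-below ∑excess≡1 a≢b Sa<s Sb<s = <-irrefl refl (begin-strict
      1                     <⟨ +-mono-≤ (m<n⇒0<n∸m Sa<s) (m<n⇒0<n∸m Sb<s) ⟩
      deficit _ + deficit _ ≤⟨ ∑-pair-≤ deficit a≢b ⟩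
      ∑ deficit             ≡⟨ sym balance ⟩
      ∑ excess              ≡⟨ ∑excess≡1 ⟩
      1                     ∎)
      where open ≤-Reasoning

    no-two-above : ∑ deficit ≡ 1 → ∀ {a b} → a ≢ b → s < S a → s < S b → ⊥
    no-two-above ∑deficit≡1 a≢b s<Sa s<Sb = <-irrefl refl (begin-strict
      1                     <⟨ +-mono-≤ (m<n⇒0<n∸m s<Sa) (m<n⇒0<n∸m s<Sb) ⟩
      excess _ + excess _   ≤⟨ ∑-pair-≤ excess a≢b ⟩
      ∑ excess              ≡⟨ balance ⟩
      ∑ deficit             ≡⟨ ∑deficit≡1 ⟩
      1                     ∎)
      where open ≤-Reasoning

    module Anchored {i e j} (Si<s : S i < s) (Se≡s : S e ≡ s) (Sj≡1+s : S j ≡ suc s) where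

      s<Sj : s < S j
      s<Sj = subst (s <_) (sym Sj≡1+s) ≤-refl

      Si<Se : S i < S e
      Si<Se = subst (S i <_) (sym Se≡s) Si<s

      Se<Sj : S e < S j
      Se<Sj = subst (_< S j) (sym Se≡s) s<Sj

      Si<Sj : S i < S j
      Si<Sj = <-trans Si<Se Se<Sj

      ∑excess≡1 : ∀ {a b} → a ≢ b → S a < S e → S b < S e → ∑ excess ≡ 1
      ∑excess≡1 a≢b Sa<Se Sb<Se =
        trans (∑-vanishing-on-three a≢b (apart Sa<Se) (apart (<-trans Sa<Se Se<Sj)) (apart Sb<Se)
                                    (apart (<-trans Sb<Se Se<Sj)) (apart Se<Sj) excess
                                    (m≤n⇒m∸n≡0 (below Sa<Se)) (m≤n⇒m∸n≡0 (below Sb<Se))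
                                    (m≤n⇒m∸n≡0 (≤-reflexive Se≡s)))
              (trans (cong (_∸ s) Sj≡1+s) (m+n∸n≡m 1 s))
        where
        below : ∀ {k} → S k < S e → S k ≤ s
        below Sk<Se = ≤-trans (<⇒≤ Sk<Se) (≤-reflexive Se≡s)

      low≡s-1 : S i + 1 ≡ s
      low≡s-1 with m≤n⇒m<n∨m≡n Si<s
      ... | inj₂ 1+Si≡s = trans (+-comm (S i) 1) 1+Si≡s
      ... | inj₁ 1+Si<s with gapFree-attains gapFree (n≤1+n (S i)) (<⇒≤ (<-trans 1+Si<s s<Sj))
      ...   | l , Sl≡1+Si =
        ⊥-elim (no-two-below (∑excess≡1 (apart Si<Sl) Si<Se Sl<Se) (apart Si<Sl) Si<s Sl<s)
        where
        Si<Sl : S i < S l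
        Si<Sl = subst (S i <_) (sym Sl≡1+Si) ≤-refl
        Sl<s : S l < s
        Sl<s = subst (_< s) (sym Sl≡1+Si) 1+Si<s
        Sl<Se : S l < S e
        Sl<Se = subst (S l <_) (sym Se≡s) Sl<s

      others≡s : ∀ k → k ≢ i → k ≢ j → S k ≡ s
      others≡s k k≢i k≢j with <-cmp (S k) s
      ... | tri≈ _ Sk≡s _ = Sk≡s
      ... | tri< Sk<s _ _ = ⊥-elim (no-two-below (∑excess≡1 (k≢i ∘ sym) Si<Se Sk<Se) (k≢i ∘ sym) Si<s Sk<s)
        where
        Sk<Se : S k < S e
        Sk<Se = subst (S k <_) (sym Se≡s) Sk<s
      ... | tri> _ _ s<Sk = ⊥-elim (no-two-above ∑deficit≡1 (k≢j ∘ sym) s<Sj s<Sk)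
        where
        Se<Sk : S e < S k
        Se<Sk = subst (_< S k) (sym Se≡s) s<Sk
        ∑deficit≡1 : ∑ deficit ≡ 1
        ∑deficit≡1 =
          trans (∑-vanishing-on-three (apart Se<Sj) (apart Se<Sk) (apart Si<Se ∘ sym) (k≢j ∘ sym)
                                      (apart Si<Sj ∘ sym) k≢i deficit
                                      (m≤n⇒m∸n≡0 (≤-reflexive (sym Se≡s))) (m≤n⇒m∸n≡0 (<⇒≤ s<Sj))
                                      (m≤n⇒m∸n≡0 (<⇒≤ s<Sk)))
                (trans (cong (_∸ S i) (sym low≡s-1)) (m+n∸m≡n (S i) 1))

  gapFree⇒almostEquitable : ¬ (∀ k → S k ≡ s) → AlmostEquitable s S
  gapFree⇒almostEquitable ¬exact with low-and-high ¬exact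
  ... | (i , Si<s) , (h , s<Sh)
    with gapFree-attains gapFree (<⇒≤ Si<s) (<⇒≤ s<Sh)
       | gapFree-attains gapFree (≤-trans (<⇒≤ Si<s) (n≤1+n s)) s<Sh
  ... | e , Se≡s | j , Sj≡1+s = i , j , apart Si<Sj , low≡s-1 , trans Sj≡1+s (+-comm 1 s) , others≡s
    where open Anchored Si<s Se≡s Sj≡1+s

lemma4 : (n s : ℕ) → 0 < n → 4 * s ≡ suc n C 2 →
         (p : Fin 4 → ℕ) →
         p f0 ≤ p (fs f0) → p (fs f0) ≤ p (fs (fs f0)) → p (fs (fs f0)) ≤ p (fs (fs (fs f0))) →
         (∀ i → 0 < p i) →
         prefixP p (fs (fs (fs f0))) ≡ n →
         (∀ j → suc (toℕ j) * s ≤ topSum n (prefixP p j)) →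
         ¬ (Σ (Partition4 n) (λ f → Implements f p × Equitable s f)) →
         (f : Partition4 n) → Minimal s p f →
         Σ (Fin 4) (λ i → Σ (Fin 4) (λ j → i ≢ j × blockSum f i + 1 ≡ s × blockSum f j ≡ s + 1
           × (∀ k → k ≢ i → k ≢ j → blockSum f k ≡ s)))
lemma4 n s _ 4s≡total p p₀≤p₁ p₁≤p₂ p₂≤p₃ _ _ prefixBound noEquitable f minimal =
  gapFree⇒almostEquitable total (minimal⇒gapFree sorted prefixBound total minimal)
                          (λ equitable → noEquitable (f , proj₁ minimal , equitable))
  where
  sorted : NonDecreasing p
  sorted f0           = p₀≤p₁
  sorted (fs f0)      = p₁≤p₂
  sorted (fs (fs f0)) = p₂≤p₃
  total : ∑[ k < 4 ] blockSum f k ≡ 4 * s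
  total = trans (∑-blockSum f) (sym 4s≡total)
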